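{- Let $d\ge1$ and let $\mathcal S=\{[k_1,l_1],\dots,[k_i,l_i]\}$, $i\ge 1$, be a family of pairwise disjoint intervals of $[1,d]$ as in the context, with $\mathcal S\ne\{[1,d]^*\}$, and let $\mathcal S'$ be its associated family. If $l_i\neq d$, then exactly one interval among the intervals of $\mathcal S$ and $\mathcal S'$ is wrapped. If $l_i=d$, then no interval of $\mathcal S$ or of $\mathcal S'$ is wrapped.
   Context: For $1\le k,l\le d$, $[k,l]=\{k,\dots,l\}$ if $k\le l$, and if $k>l$, $[k,l]=\{k,\dots,d,1,\dots,l\}$, called wrapped; $[1,d]^*$ denotes the whole set regarded as a wrapped interval. A family $\mathcal S=\{[k_1,l_1],\dots,[k_i,l_i]\}$ of pairwise disjoint intervals is listed so that $1\le k_1\le l_1<k_2\le l_2<\dots<k_i\le d$ and either $k_i\le l_i\le d$ or $1\le l_i<k_1$. Its associated family is $\mathcal S'=\{[d-k_i+1,d-l_{i-1}],\dots,[d-k_2+1,d-l_1],[d-k_1+1,d-l_i]\}$, where an endpoint equal to $0$ is read as $d$, and an interval $[a,b]$ with $a>b$ is the wrapped interval $\{a,\dots,d,1,\dots,b\}$. -}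

module Defs where

open import Data.Nat using (ℕ; zero; suc; _+_; _∸_; _≤_; _<_; _<ᵇ_)
open import Data.Bool using (Bool)
open import Data.Product using (_×_; _,_; proj₁; proj₂)
open import Data.Sum using (_⊎_)
open import Data.List using (List; []; _∷_; _++_; map; length; filterᵇ; applyUpTo)
open import Relation.Binary.PropositionalEquality using (_≡_)
open import Relation.Nullary using (¬_)

Interval : Set
Interval = ℕ × ℕ

Wrapped : Interval → Set
Wrapped (a , b) = b < a

isWrapped : Interval → Bool
isWrapped (a , b) = b <ᵇ a

-- Endpoint convention: an endpoint equal to 0 is read as d.
readEnd : ℕ → ℕ → ℕ
readEnd d zero    = d
readEnd d (suc x) = suc x

-- A family S = {[k_1,l_1],…,[k_i,l_i]} is given by i and functions k l : ℕ → ℕ,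
-- of which only the values at indices 1,…,i matter.
record ValidFamily (d i : ℕ) (k l : ℕ → ℕ) : Set where
  field
    i≥1     : 1 ≤ i
    k-range : ∀ j → 1 ≤ j → j ≤ i → 1 ≤ k j × k j ≤ d
    l-range : ∀ j → 1 ≤ j → j ≤ i → 1 ≤ l j × l j ≤ d
    chain   : ∀ j → 1 ≤ j → j < i → k j ≤ l j × l j < k (suc j)
    last    : k i ≤ l i ⊎ l i < k 1

-- S = {[1,d]^*}: S consists of the single wrapped interval covering all of [1,d],
-- i.e. i = 1 and [k_1,l_1] = [k_1, k_1 - 1] with k_1 > l_1.
IsWholeWrapped : (d i : ℕ) (k l : ℕ → ℕ) → Set
IsWholeWrapped d i k l = i ≡ 1 × l 1 < k 1 × suc (l 1) ≡ k 1

family : (i : ℕ) (k l : ℕ → ℕ) → List Interval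
family i k l = applyUpTo (λ j → (k (suc j) , l (suc j))) i

-- The associated family S' =
--   {[d-k_i+1, d-l_{i-1}], …, [d-k_2+1, d-l_1], [d-k_1+1, d-l_i]}
-- (listed here in the order j = 2,…,i followed by j = 1; order is irrelevant),
-- with endpoints equal to 0 read as d.
assocFamily : (d i : ℕ) (k l : ℕ → ℕ) → List Interval
assocFamily d i k l =
  applyUpTo (λ m → (d ∸ k (suc (suc m)) + 1 , readEnd d (d ∸ l (suc m)))) (i ∸ 1)
  ++ ((d ∸ k 1 + 1 , readEnd d (d ∸ l i)) ∷ [])

countWrapped : List Interval → ℕ
countWrapped xs = length (filterᵇ isWrapped xs)

module Submission where

-- Consecutive intervals of S satisfy l_j < k_{j+1}, so every interval of S except the last,
-- and every interval [d-k_{j+1}+1, d-l_j] of S' except [d-k_1+1, d-l_i], is unwrapped.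
-- Everything is decided by the two remaining intervals: [k_i,l_i] is wrapped exactly when
-- l_i < k_1, and then d-l_i ≥ d-k_1+1; otherwise k_1 ≤ k_i ≤ l_i, so [d-k_1+1, d-l_i] is
-- wrapped unless l_i = d, where the endpoint 0 is read as d.

open import Defs
open import Data.Nat using (ℕ; zero; suc; _+_; _∸_; _≤_; _<_; _<ᵇ_; z≤n; s≤s; z<s; s<s)
open import Data.Nat.Properties
open import Data.Bool using (true; false; T)
open import Data.Unit using (tt)
open import Data.Product using (_×_; _,_; proj₁; proj₂)
open import Data.Sum using (inj₁; inj₂)
open import Data.List using ([]; _∷_; _++_; applyUpTo)
open import Data.List.Properties using (applyUpTo-∷ʳ)
open import Function using (_∘_)
open import Relation.Binary.PropositionalEquality
open import Relation.Nullary using (¬_; contradiction)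

countWrapped-++ : ∀ xs ys → countWrapped (xs ++ ys) ≡ countWrapped xs + countWrapped ys
countWrapped-++ []       ys = refl
countWrapped-++ (x ∷ xs) ys with isWrapped x
... | true  = cong suc (countWrapped-++ xs ys)
... | false = countWrapped-++ xs ys

countWrapped-unwrapped : ∀ {a b} → a ≤ b → countWrapped ((a , b) ∷ []) ≡ 0
countWrapped-unwrapped {a} {b} a≤b with b <ᵇ a in eq
... | false = refl
... | true  = contradiction (<ᵇ⇒< b a (subst T (sym eq) tt)) (≤⇒≯ a≤b)

countWrapped-wrapped : ∀ {a b} → b < a → countWrapped ((a , b) ∷ []) ≡ 1
countWrapped-wrapped {a} {b} b<a with b <ᵇ a | <⇒<ᵇ b<a
... | true | _ = refl

countWrapped-applyUpTo : ∀ (f : ℕ → Interval) n → (∀ m → m < n → proj₁ (f m) ≤ proj₂ (f m))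
  → countWrapped (applyUpTo f n) ≡ 0
countWrapped-applyUpTo f zero    _       = refl
countWrapped-applyUpTo f (suc n) unwrapped =
  trans (countWrapped-++ (f 0 ∷ []) (applyUpTo (f ∘ suc) n))
        (cong₂ _+_ (countWrapped-unwrapped (unwrapped 0 z<s))
                   (countWrapped-applyUpTo (f ∘ suc) n (λ m m<n → unwrapped (suc m) (s<s m<n))))

readEnd-pos : ∀ d {x} → 0 < x → readEnd d x ≡ x
readEnd-pos d {suc x} _ = refl

d∸K+1≤d∸L : ∀ {d K L} → L < K → K ≤ d → d ∸ K + 1 ≤ d ∸ L
d∸K+1≤d∸L {d} {K} {L} L<K K≤d = subst (_≤ d ∸ L) (+-comm 1 (d ∸ K)) (∸-monoʳ-< L<K K≤d)

mirror-unwrapped : ∀ {d K L} → L < K → K ≤ d → d ∸ K + 1 ≤ readEnd d (d ∸ L)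
mirror-unwrapped {d} {K} L<K K≤d =
  subst (d ∸ K + 1 ≤_) (sym (readEnd-pos d (≤-<-trans z≤n (∸-monoʳ-< L<K K≤d)))) (d∸K+1≤d∸L L<K K≤d)

mirror-wrapped : ∀ {d K L} → K ≤ L → L < d → readEnd d (d ∸ L) < d ∸ K + 1
mirror-wrapped {d} {K} {L} K≤L L<d =
  subst (_< d ∸ K + 1) (sym (readEnd-pos d (m<n⇒0<n∸m L<d)))
        (subst (d ∸ L <_) (+-comm 1 (d ∸ K)) (s≤s (∸-monoʳ-≤ d K≤L)))

mirror-full : ∀ {d K} → 1 ≤ K → K ≤ d → d ∸ K + 1 ≤ readEnd d (d ∸ d)
mirror-full {d} {K} 1≤K K≤d = subst (λ x → d ∸ K + 1 ≤ readEnd d x) (sym (n∸n≡0 d)) (d∸K+1≤d∸L 1≤K K≤d)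

module _ {d n : ℕ} {k l : ℕ → ℕ} (V : ValidFamily d (suc n) k l) where
  open ValidFamily V

  lastInterval : Interval
  lastInterval = (k (suc n) , l (suc n))

  lastMirror : Interval
  lastMirror = (d ∸ k 1 + 1 , readEnd d (d ∸ l (suc n)))

  k₁≤k : ∀ j → suc j ≤ suc n → k 1 ≤ k (suc j)
  k₁≤k zero    _    = ≤-refl
  k₁≤k (suc j) sj<i = ≤-trans (k₁≤k j (<⇒≤ sj<i)) (≤-trans kⱼ≤lⱼ (<⇒≤ lⱼ<kⱼ₊₁))
    where
    kⱼ≤lⱼ : k (suc j) ≤ l (suc j)
    kⱼ≤lⱼ = proj₁ (chain (suc j) (s≤s z≤n) sj<i)
    lⱼ<kⱼ₊₁ : l (suc j) < k (suc (suc j))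
    lⱼ<kⱼ₊₁ = proj₂ (chain (suc j) (s≤s z≤n) sj<i)

  countWrapped-family++assoc : countWrapped (family (suc n) k l ++ assocFamily d (suc n) k l)
    ≡ countWrapped (lastInterval ∷ []) + countWrapped (lastMirror ∷ [])
  countWrapped-family++assoc = begin
    countWrapped (family (suc n) k l ++ assocFamily d (suc n) k l)
      ≡⟨ cong (λ xs → countWrapped (xs ++ assocFamily d (suc n) k l)) (sym (applyUpTo-∷ʳ F n)) ⟩
    countWrapped ((applyUpTo F n ++ lastInterval ∷ []) ++ (applyUpTo G n ++ lastMirror ∷ []))
      ≡⟨ countWrapped-++ (applyUpTo F n ++ lastInterval ∷ []) _ ⟩
    countWrapped (applyUpTo F n ++ lastInterval ∷ []) + countWrapped (applyUpTo G n ++ lastMirror ∷ [])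
      ≡⟨ cong₂ _+_ (countWrapped-++ (applyUpTo F n) _) (countWrapped-++ (applyUpTo G n) _) ⟩
    (countWrapped (applyUpTo F n) + countWrapped (lastInterval ∷ []))
      + (countWrapped (applyUpTo G n) + countWrapped (lastMirror ∷ []))
      ≡⟨ cong₂ (λ u v → (u + countWrapped (lastInterval ∷ [])) + (v + countWrapped (lastMirror ∷ [])))
               (countWrapped-applyUpTo F n F-unwrapped) (countWrapped-applyUpTo G n G-unwrapped) ⟩
    countWrapped (lastInterval ∷ []) + countWrapped (lastMirror ∷ []) ∎
    where
    open ≡-Reasoning
    F G : ℕ → Interval
    F j = (k (suc j) , l (suc j))
    G m = (d ∸ k (suc (suc m)) + 1 , readEnd d (d ∸ l (suc m)))
    F-unwrapped : ∀ m → m < n → proj₁ (F m) ≤ proj₂ (F m)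
    F-unwrapped m m<n = proj₁ (chain (suc m) (s≤s z≤n) (s<s m<n))
    G-unwrapped : ∀ m → m < n → proj₁ (G m) ≤ proj₂ (G m)
    G-unwrapped m m<n = mirror-unwrapped (proj₂ (chain (suc m) (s≤s z≤n) (s<s m<n)))
                                         (proj₂ (k-range (suc (suc m)) (s≤s z≤n) (s<s m<n)))

  private
    k₁-range : 1 ≤ k 1 × k 1 ≤ d
    k₁-range = k-range 1 (s≤s z≤n) (s≤s z≤n)

    lᵢ≤d : l (suc n) ≤ d
    lᵢ≤d = proj₂ (l-range (suc n) (s≤s z≤n) ≤-refl)

    k₁≤kᵢ : k 1 ≤ k (suc n)
    k₁≤kᵢ = k₁≤k n ≤-refl

  countWrapped-last-≢ : ¬ l (suc n) ≡ d
    → countWrapped (lastInterval ∷ []) + countWrapped (lastMirror ∷ []) ≡ 1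
  countWrapped-last-≢ lᵢ≢d with last
  ... | inj₂ lᵢ<k₁ = cong₂ _+_ (countWrapped-wrapped (<-≤-trans lᵢ<k₁ k₁≤kᵢ))
                               (countWrapped-unwrapped (mirror-unwrapped lᵢ<k₁ (proj₂ k₁-range)))
  ... | inj₁ kᵢ≤lᵢ = cong₂ _+_ (countWrapped-unwrapped kᵢ≤lᵢ)
                               (countWrapped-wrapped (mirror-wrapped (≤-trans k₁≤kᵢ kᵢ≤lᵢ) (≤∧≢⇒< lᵢ≤d lᵢ≢d)))

  countWrapped-last-≡ : l (suc n) ≡ d
    → countWrapped (lastInterval ∷ []) + countWrapped (lastMirror ∷ []) ≡ 0
  countWrapped-last-≡ lᵢ≡d with last
  ... | inj₂ lᵢ<k₁ = contradiction lᵢ≡d (<⇒≢ (<-≤-trans lᵢ<k₁ (proj₂ k₁-range)))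
  ... | inj₁ kᵢ≤lᵢ = cong₂ _+_ (countWrapped-unwrapped kᵢ≤lᵢ)
    (subst (λ x → countWrapped ((d ∸ k 1 + 1 , readEnd d (d ∸ x)) ∷ []) ≡ 0) (sym lᵢ≡d)
           (countWrapped-unwrapped (mirror-full (proj₁ k₁-range) (proj₂ k₁-range))))

lemma4p4 : (d i : ℕ) (k l : ℕ → ℕ) → 1 ≤ d → ValidFamily d i k l
    → ¬ IsWholeWrapped d i k l
    → (¬ l i ≡ d → countWrapped (family i k l ++ assocFamily d i k l) ≡ 1)
    × (l i ≡ d → countWrapped (family i k l ++ assocFamily d i k l) ≡ 0)
lemma4p4 d zero    k l _ V _ = contradiction (ValidFamily.i≥1 V) (λ ())
lemma4p4 d (suc n) k l _ V _ =
  (λ lᵢ≢d → trans (countWrapped-family++assoc V) (countWrapped-last-≢ V lᵢ≢d)) ,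
  (λ lᵢ≡d → trans (countWrapped-family++assoc V) (countWrapped-last-≡ V lᵢ≡d))
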